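{- Let $x$ be an infinite word over a finite alphabet and let $x=V_0V_1V_2\cdots$ be a prefixal factorization of $x$. Then there exists a unique factorization $\delta(x)=v_0v_1v_2\cdots$ into non-empty words such that $\phi(v_i)=V_i$ for each $i\ge0$ (where $\phi$ is extended to a morphism).
   Context: A prefixal factorization of $x$ is a factorization $x=V_0V_1\cdots$ with every $V_i$ a non-empty prefix of $x$; in particular $x\in\mathcal{P}_1$, the set of infinite words admitting a prefixal factorization. A finite non-empty word is unbordered if no non-empty word other than itself is both a prefix and a suffix of it; $UP(x)$ is the set of non-empty unbordered prefixes of $x$. Each $x\in\mathcal{P}_1$ has a unique factorization $x=U_0U_1\cdots$ with $U_i\in UP(x)$. With $UP'(x)=\{U_i:i\ge0\}$, $n_x=\mathrm{card}(UP'(x))$, $UP'(x)$ ordered by index of first occurrence in this factorization, and $\phi:\{1,\dots,n_x\}\to UP'(x)$ the order-preserving bijection (extended to a morphism on $\{1,\dots,n_x\}^+$), the derived word is $\delta(x)=\phi^{ -1}(U_0)\phi^{ -1}(U_1)\cdots\in\{1,\dots,n_x\}^\omega$. -}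

module Defs where

open import Data.Nat using (ℕ; zero; suc; _+_; _∸_; _<_)
open import Data.Fin using (Fin)
open import Data.Fin.Properties renaming (_≟_ to _≟F_)
open import Data.List using (List; []; _∷_; _++_; map; upTo; length; [_])
open import Data.List.Properties using (≡-dec)
open import Data.Product using (Σ; ∃; _×_)
open import Relation.Nullary using (¬_; yes; no)
import Relation.Nullary
import Data.Bool
import Data.Maybe
open import Relation.Binary.PropositionalEquality using (_≡_)

slice : {B : Set} → (ℕ → B) → ℕ → ℕ → List B
slice s i j = map (λ k → s (i + k)) (upTo (j ∸ i))

pref : {B : Set} → (ℕ → B) → ℕ → List B
pref s n = slice s 0 n

record Factorization {B : Set} (s : ℕ → B) : Set where
  field
    cut  : ℕ → ℕ
    cut0 : cut 0 ≡ 0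
    cut< : ∀ i → cut i < cut (suc i)

  block : ℕ → List B
  block i = slice s (cut i) (cut (suc i))

open Factorization public

IsPrefixOf : {B : Set} → List B → (ℕ → B) → Set
IsPrefixOf w s = w ≡ pref s (length w)

IsPrefix : {B : Set} → List B → List B → Set
IsPrefix {B} u w = Σ (List B) (λ t → u ++ t ≡ w)

IsSuffix : {B : Set} → List B → List B → Set
IsSuffix {B} u w = Σ (List B) (λ t → t ++ u ≡ w)

Unbordered : {B : Set} → List B → Set
Unbordered w = ¬ (w ≡ []) × (∀ u → ¬ (u ≡ []) → IsPrefix u w → IsSuffix u w → u ≡ w)

Prefixal : {B : Set} {s : ℕ → B} → Factorization s → Set
Prefixal {s = s} F = ∀ i → IsPrefixOf (block F i) s

UnborderedPrefixal : {B : Set} {s : ℕ → B} → Factorization s → Set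
UnborderedPrefixal {s = s} F = ∀ i → IsPrefixOf (block F i) s × Unbordered (block F i)

module Derived {k : ℕ} {x : ℕ → Fin k} (U : Factorization x) where

  _≟W_ : (u v : List (Fin k)) → Relation.Nullary.Dec (u ≡ v)
  _≟W_ = ≡-dec _≟F_

  elem : List (Fin k) → List (List (Fin k)) → Data.Bool.Bool
  elem w [] = Data.Bool.false
  elem w (v ∷ vs) with w ≟W v
  ... | yes _ = Data.Bool.true
  ... | no _  = elem w vs

  indexOf : List (Fin k) → List (List (Fin k)) → ℕ
  indexOf w [] = 0
  indexOf w (v ∷ vs) with w ≟W v
  ... | yes _ = 0
  ... | no _  = suc (indexOf w vs)

  seen : ℕ → List (List (Fin k))
  seen zero = []
  seen (suc n) with elem (block U n) (seen n)
  ... | Data.Bool.true  = seen n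
  ... | Data.Bool.false = seen n ++ [ block U n ]

  -- the derived word δ(x): δ i = φ⁻¹(U i) ∈ {1, …, n_x}, where φ enumerates UP'(x)
  -- in order of first occurrence (letters are the positive naturals 1, 2, …)
  δ : ℕ → ℕ
  δ i = suc (indexOf (block U i) (seen (suc i)))

  nth : List (List (Fin k)) → ℕ → Data.Maybe.Maybe (List (Fin k))
  nth [] m = Data.Maybe.nothing
  nth (w ∷ ws) zero = Data.Maybe.just w
  nth (w ∷ ws) (suc m) = nth ws m

  -- φ : {1, …, n_x} → UP'(x) is the order-preserving bijection: the letter m+1 is sent to
  -- the (m+1)-th distinct factor in order of first occurrence.  (Values of φ outside
  -- {1, …, n_x} are irrelevant; φ is extended to words as the morphism concatMap φ.)
  IsPhi : (ℕ → List (Fin k)) → Set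
  IsPhi φ = ∀ n m w → nth (seen n) m ≡ Data.Maybe.just w → φ (suc m) ≡ w

-- Every cut point of a prefixal factorization V is already a cut point of the
-- factorization U into unbordered prefixes: were a cut of V strictly inside a block U_j,
-- the last such cut would start a factor of V, hence a prefix of x, which ends at or
-- after the end of U_j; the part inside U_j is then a proper non-empty suffix of U_j
-- which is also a prefix of x, hence of U_j, so U_j would be bordered.  Thus each V_i
-- is a concatenation U_a ⋯ U_{b-1}, and since φ (δ j) = U_j, the block δ[a .. b) of the
-- derived word is mapped to V_i by φ.  Uniqueness: φ ∘ δ maps letters to the blocks of
-- U, so the image of δ[a .. b) determines b from a.
module Submission where

open import Defs
open import Data.Nat using (ℕ; zero; suc; _+_; _∸_; _<_; _≤_; z≤n; s≤s; s≤s⁻¹; _<?_)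
open import Data.Nat.Properties
open import Data.Fin using (Fin)
open import Data.List using (List; []; _∷_; _++_; map; upTo; length; applyUpTo; concatMap; [_])
open import Data.List.Properties
  using (map-upTo; length-applyUpTo; length-++; length-++-≤ˡ; length-++-≤ʳ; concatMap-++; ++-identityʳ)
open import Data.Product using (Σ; ∃-syntax; _×_; _,_; proj₁; proj₂)
open import Data.Sum using (inj₁; inj₂)
open import Data.Empty using (⊥; ⊥-elim)
open import Data.Bool using (true; false)
open import Data.Maybe using (just)
open import Relation.Nullary using (¬_; yes; no)
open import Relation.Binary.Definitions using (tri<; tri≈; tri>)
open import Relation.Binary.PropositionalEquality hiding ([_])
open ≡-Reasoning

[n∸m]+[o∸n]≡o∸m : ∀ {m n o} → m ≤ n → n ≤ o → (n ∸ m) + (o ∸ n) ≡ o ∸ m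
[n∸m]+[o∸n]≡o∸m {m} {n} {o} m≤n n≤o = begin
  (n ∸ m) + (o ∸ n)   ≡⟨ +-comm (n ∸ m) (o ∸ n) ⟩
  (o ∸ n) + (n ∸ m)   ≡⟨ +-∸-assoc (o ∸ n) m≤n ⟨
  ((o ∸ n) + n) ∸ m   ≡⟨ cong (_∸ m) (m∸n+n≡m n≤o) ⟩
  o ∸ m               ∎

applyUpTo-cong : {A : Set} {f g : ℕ → A} → (∀ t → f t ≡ g t) →
  ∀ n → applyUpTo f n ≡ applyUpTo g n
applyUpTo-cong f≗g zero    = refl
applyUpTo-cong f≗g (suc n) = cong₂ _∷_ (f≗g 0) (applyUpTo-cong (λ t → f≗g (suc t)) n)

applyUpTo-++ : {A : Set} (f : ℕ → A) (m n : ℕ) →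
  applyUpTo f m ++ applyUpTo (λ t → f (m + t)) n ≡ applyUpTo f (m + n)
applyUpTo-++ f zero    n = refl
applyUpTo-++ f (suc m) n = cong (f 0 ∷_) (applyUpTo-++ (λ t → f (suc t)) m n)

++-cancel-length : {A : Set} (t u : List A) {v w : List A} →
  length t ≡ length u → t ++ v ≡ u ++ w → t ≡ u
++-cancel-length []      []      _   _  = refl
++-cancel-length (a ∷ t) (b ∷ u) |t|≡|u| eq =
  cong₂ _∷_ (cong (λ { [] → a ; (c ∷ _) → c }) eq)
            (++-cancel-length t u (suc-injective |t|≡|u|) (cong (λ { [] → [] ; (_ ∷ r) → r }) eq))

module _ {B : Set} (s : ℕ → B) where

  slice≡applyUpTo : ∀ i j → slice s i j ≡ applyUpTo (λ t → s (i + t)) (j ∸ i)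
  slice≡applyUpTo i j = map-upTo _ (j ∸ i)

  length-slice : ∀ i j → length (slice s i j) ≡ j ∸ i
  length-slice i j = trans (cong length (slice≡applyUpTo i j)) (length-applyUpTo _ (j ∸ i))

  slice-empty : ∀ i → slice s i i ≡ []
  slice-empty i = cong (λ n → map (λ t → s (i + t)) (upTo n)) (n∸n≡0 i)

  slice-singleton : ∀ i → slice s i (suc i) ≡ [ s i ]
  slice-singleton i = trans (cong (λ n → map (λ t → s (i + t)) (upTo n)) (m+n∸n≡m 1 i))
                            (cong (λ p → [ s p ]) (+-identityʳ i))

  slice-nonempty : ∀ {i j} → i < j → ¬ slice s i j ≡ []
  slice-nonempty {i} {j} i<j empty =
    <⇒≢ (m<n⇒0<n∸m i<j) (sym (trans (sym (length-slice i j)) (cong length empty)))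

  slice-++ : ∀ {i j l} → i ≤ j → j ≤ l → slice s i j ++ slice s j l ≡ slice s i l
  slice-++ {i} {j} {l} i≤j j≤l = begin
    slice s i j ++ slice s j l
      ≡⟨ cong₂ _++_ (slice≡applyUpTo i j) (slice≡applyUpTo j l) ⟩
    applyUpTo (λ t → s (i + t)) (j ∸ i) ++ applyUpTo (λ t → s (j + t)) (l ∸ j)
      ≡⟨ cong (applyUpTo (λ t → s (i + t)) (j ∸ i) ++_) (applyUpTo-cong j+t≡i+[[j∸i]+t] (l ∸ j)) ⟩
    applyUpTo (λ t → s (i + t)) (j ∸ i) ++ applyUpTo (λ t → s (i + ((j ∸ i) + t))) (l ∸ j)
      ≡⟨ applyUpTo-++ (λ t → s (i + t)) (j ∸ i) (l ∸ j) ⟩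
    applyUpTo (λ t → s (i + t)) ((j ∸ i) + (l ∸ j))
      ≡⟨ cong (applyUpTo (λ t → s (i + t))) ([n∸m]+[o∸n]≡o∸m i≤j j≤l) ⟩
    applyUpTo (λ t → s (i + t)) (l ∸ i)
      ≡⟨ slice≡applyUpTo i l ⟨
    slice s i l ∎
    where
    j+t≡i+[[j∸i]+t] : ∀ t → s (j + t) ≡ s (i + ((j ∸ i) + t))
    j+t≡i+[[j∸i]+t] t = cong s (trans (cong (_+ t) (sym (m+[n∸m]≡n i≤j))) (+-assoc i (j ∸ i) t))

  slice-injectiveʳ : ∀ {i j l} → i ≤ j → i ≤ l → slice s i j ≡ slice s i l → j ≡ l
  slice-injectiveʳ {i} {j} {l} i≤j i≤l eq = ∸-cancelʳ-≡ i≤j i≤l (begin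
    j ∸ i                   ≡⟨ length-slice i j ⟨
    length (slice s i j)    ≡⟨ cong length eq ⟩
    length (slice s i l)    ≡⟨ length-slice i l ⟩
    l ∸ i                   ∎)

  IsPrefixOf⇒IsPrefix : ∀ {u w} → IsPrefixOf u s → IsPrefixOf w s →
    length u ≤ length w → IsPrefix u w
  IsPrefixOf⇒IsPrefix {u} {w} u≡ w≡ |u|≤|w| = slice s (length u) (length w) , (begin
    u ++ slice s (length u) (length w)               ≡⟨ cong (_++ slice s (length u) (length w)) u≡ ⟩
    pref s (length u) ++ slice s (length u) (length w) ≡⟨ slice-++ z≤n |u|≤|w| ⟩
    pref s (length w)                                ≡⟨ w≡ ⟨
    w                                                ∎)

  IsPrefixOf-++⁻ˡ : ∀ u {v} → IsPrefixOf (u ++ v) s → IsPrefixOf u s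
  IsPrefixOf-++⁻ˡ u {v} uv≡ = ++-cancel-length u (pref s (length u))
    (sym (length-slice 0 (length u)))
    (trans uv≡ (sym (slice-++ z≤n (length-++-≤ˡ u {v}))))

  unbordered-prefix-suffix : ∀ {w} t u → IsPrefixOf w s → Unbordered w → w ≡ t ++ u →
    ¬ t ≡ [] → ¬ u ≡ [] → IsPrefixOf u s → ⊥
  unbordered-prefix-suffix []      u _ _ _ t≢[] _ _ = t≢[] refl
  unbordered-prefix-suffix {w} (a ∷ t) u w≡ (_ , unbordered) w≡tu _ u≢[] u≡ =
    m≢1+n+m (length u) (begin
      length u             ≡⟨ cong length (unbordered u u≢[] u⊑w (a ∷ t , sym w≡tu)) ⟩
      length w             ≡⟨ cong length w≡tu ⟩
      length (a ∷ t ++ u)  ≡⟨ length-++ (a ∷ t) ⟩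
      suc (length t + length u) ∎)
    where
    u⊑w : IsPrefix u w
    u⊑w = IsPrefixOf⇒IsPrefix u≡ w≡
      (subst (λ v → length u ≤ length v) (sym w≡tu) (length-++-≤ʳ u {a ∷ t}))

  unbordered-block-no-overlap : ∀ {a c b d} → a < c → c < b → b ≤ d →
    IsPrefixOf (slice s a b) s → Unbordered (slice s a b) → IsPrefixOf (slice s c d) s → ⊥
  unbordered-block-no-overlap {a} {c} {b} {d} a<c c<b b≤d ab≡ unbordered cd≡ =
    unbordered-prefix-suffix (slice s a c) (slice s c b) ab≡ unbordered
      (sym (slice-++ (<⇒≤ a<c) (<⇒≤ c<b))) (slice-nonempty a<c) (slice-nonempty c<b)
      (IsPrefixOf-++⁻ˡ (slice s c b)
        (subst (λ v → IsPrefixOf v s) (sym (slice-++ (<⇒≤ c<b) b≤d)) cd≡))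

module _ {B : Set} {s : ℕ → B} (F : Factorization s) where

  cut-strictMono : ∀ {m n} → m < n → cut F m < cut F n
  cut-strictMono {m} {suc n} (s≤s m≤n) with m≤n⇒m<n∨m≡n m≤n
  ... | inj₁ m<n  = <-trans (cut-strictMono m<n) (cut< F n)
  ... | inj₂ refl = cut< F n

  cut-mono : ∀ {m n} → m ≤ n → cut F m ≤ cut F n
  cut-mono m≤n with m≤n⇒m<n∨m≡n m≤n
  ... | inj₁ m<n  = <⇒≤ (cut-strictMono m<n)
  ... | inj₂ refl = ≤-refl

  cut-cancel-< : ∀ {m n} → cut F m < cut F n → m < n
  cut-cancel-< {m} {n} lt = ≰⇒> (λ n≤m → <⇒≱ lt (cut-mono n≤m))

  cut-injective : ∀ {m n} → cut F m ≡ cut F n → m ≡ n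
  cut-injective {m} {n} eq with <-cmp m n
  ... | tri< m<n _ _ = ⊥-elim (<⇒≢ (cut-strictMono m<n) eq)
  ... | tri≈ _ m≡n _ = m≡n
  ... | tri> _ _ n<m = ⊥-elim (<⇒≢ (cut-strictMono n<m) (sym eq))

  block-containing : ∀ p → ∃[ j ] cut F j ≤ p × p < cut F (suc j)
  block-containing zero = 0 , ≤-reflexive (cut0 F) , subst (_< cut F 1) (cut0 F) (cut< F 0)
  block-containing (suc p) with block-containing p
  ... | j , jp , p<j+1 with suc p <? cut F (suc j)
  ...   | yes p+1<j+1 = j , m≤n⇒m≤1+n jp , p+1<j+1
  ...   | no  p+1≮j+1 = suc j , ≮⇒≥ p+1≮j+1 , ≤-<-trans p<j+1 (cut< F (suc j))

  block-reaching : ∀ {p} → 0 < p → ∃[ j ] cut F j < p × p ≤ cut F (suc j)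
  block-reaching {suc p} _ with block-containing p
  ... | j , jp , p<j+1 = j , s≤s jp , p<j+1

module _ {B : Set} {s : ℕ → B} (V : Factorization s) (prefixal : Prefixal V)
         (U : Factorization s) (unborderedPrefixal : UnborderedPrefixal U) where

  prefixal-cut-not-inside-unbordered-block : ∀ j i → cut U j < cut V i → cut V i < cut U (suc j) → ⊥
  prefixal-cut-not-inside-unbordered-block j i a<c c<b
    with block-reaching V (≤-<-trans z≤n (cut< U j))
  ... | i' , c'<b , b≤d =
    unbordered-block-no-overlap s a<c' c'<b b≤d
      (proj₁ (unborderedPrefixal j)) (proj₂ (unborderedPrefixal j)) (prefixal i')
    where
    -- the V-block starting at cut V i' is the one reaching the end of U_j
    a<c' : cut U j < cut V i'
    a<c' = <-≤-trans a<c (cut-mono V (s≤s⁻¹ (cut-cancel-< V (<-≤-trans c<b b≤d))))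

  prefixal-cut-is-unbordered-cut : ∀ i → ∃[ j ] cut U j ≡ cut V i
  prefixal-cut-is-unbordered-cut i with block-containing U (cut V i)
  ... | j , a≤c , c<b with m≤n⇒m<n∨m≡n a≤c
  ...   | inj₂ a≡c = j , a≡c
  ...   | inj₁ a<c = ⊥-elim (prefixal-cut-not-inside-unbordered-block j i a<c c<b)

module _ {B : Set} {s : ℕ → B} (F V : Factorization s)
         (V⊆F : ∀ i → ∃[ j ] cut F j ≡ cut V i) where

  cutIndices : {A : Set} (y : ℕ → A) → Factorization y
  cutIndices y = record
    { cut  = λ i → proj₁ (V⊆F i)
    ; cut0 = cut-injective F (trans (proj₂ (V⊆F 0)) (trans (cut0 V) (sym (cut0 F))))
    ; cut< = λ i → cut-cancel-< F
        (subst₂ _<_ (sym (proj₂ (V⊆F i))) (sym (proj₂ (V⊆F (suc i)))) (cut< V i))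
    }

module _ {A B : Set} {s : ℕ → B} (F : Factorization s) (y : ℕ → A)
         (φ : A → List B) (φ∘y≡block : ∀ j → φ (y j) ≡ block F j) where

  concatMap-slice : ∀ {m n} → m ≤ n → concatMap φ (slice y m n) ≡ slice s (cut F m) (cut F n)
  concatMap-slice {m} m≤n with m≤n⇒m<n∨m≡n m≤n
  ... | inj₂ refl = trans (cong (concatMap φ) (slice-empty y m)) (sym (slice-empty s (cut F m)))
  ... | inj₁ (s≤s {n = n} m≤n') = begin
    concatMap φ (slice y m (suc n))
      ≡⟨ cong (concatMap φ) (slice-++ y m≤n' (n≤1+n n)) ⟨
    concatMap φ (slice y m n ++ slice y n (suc n))
      ≡⟨ concatMap-++ φ (slice y m n) _ ⟩
    concatMap φ (slice y m n) ++ concatMap φ (slice y n (suc n))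
      ≡⟨ cong₂ _++_ (concatMap-slice m≤n') (cong (concatMap φ) (slice-singleton y n)) ⟩
    slice s (cut F m) (cut F n) ++ (φ (y n) ++ [])
      ≡⟨ cong (slice s (cut F m) (cut F n) ++_) (trans (++-identityʳ (φ (y n))) (φ∘y≡block n)) ⟩
    slice s (cut F m) (cut F n) ++ block F n
      ≡⟨ slice-++ s (cut-mono F m≤n') (<⇒≤ (cut< F n)) ⟩
    slice s (cut F m) (cut F (suc n)) ∎

  cut-determined-by-image : (W W' : Factorization y) →
    (∀ i → concatMap φ (block W i) ≡ concatMap φ (block W' i)) → ∀ i → cut W i ≡ cut W' i
  cut-determined-by-image W W' same zero    = trans (cut0 W) (sym (cut0 W'))
  cut-determined-by-image W W' same (suc i) =
    cut-injective F (slice-injectiveʳ s a≤b a≤b' (begin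
      slice s a (cut F (cut W (suc i)))                    ≡⟨ concatMap-slice (<⇒≤ (cut< W i)) ⟨
      concatMap φ (block W i)                              ≡⟨ same i ⟩
      concatMap φ (block W' i)                             ≡⟨ concatMap-slice (<⇒≤ (cut< W' i)) ⟩
      slice s (cut F (cut W' i)) (cut F (cut W' (suc i)))  ≡⟨ cong (λ c → slice s (cut F c) _) ih ⟨
      slice s a (cut F (cut W' (suc i)))                   ∎))
    where
    ih : cut W i ≡ cut W' i
    ih = cut-determined-by-image W W' same i

    a : ℕ
    a = cut F (cut W i)

    a≤b : a ≤ cut F (cut W (suc i))
    a≤b = cut-mono F (<⇒≤ (cut< W i))

    a≤b' : a ≤ cut F (cut W' (suc i))
    a≤b' = subst (λ c → cut F c ≤ cut F (cut W' (suc i))) (sym ih) (cut-mono F (<⇒≤ (cut< W' i)))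

module _ {k : ℕ} {x : ℕ → Fin k} (U : Factorization x) where
  open Derived U

  nth-indexOf : ∀ w ws → elem w ws ≡ true → nth ws (indexOf w ws) ≡ just w
  nth-indexOf w (v ∷ vs) w∈ with w ≟W v
  ... | yes w≡v = cong just (sym w≡v)
  ... | no  _   = nth-indexOf w vs w∈

  elem-∷ʳ : ∀ w ws → elem w (ws ++ [ w ]) ≡ true
  elem-∷ʳ w []       with w ≟W w
  ... | yes _   = refl
  ... | no  w≢w = ⊥-elim (w≢w refl)
  elem-∷ʳ w (v ∷ vs) with w ≟W v
  ... | yes _ = refl
  ... | no  _ = elem-∷ʳ w vs

  block-∈-seen : ∀ j → elem (block U j) (seen (suc j)) ≡ true
  block-∈-seen j with elem (block U j) (seen j) in seenBefore
  ... | true  = seenBefore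
  ... | false = elem-∷ʳ (block U j) (seen j)

  φ∘δ≡block : ∀ φ → IsPhi φ → ∀ j → φ (δ j) ≡ block U j
  φ∘δ≡block φ isPhi j =
    isPhi (suc j) _ (block U j) (nth-indexOf (block U j) (seen (suc j)) (block-∈-seen j))

mainTheorem10 : {k : ℕ} (x : ℕ → Fin k) (V : Factorization x) → Prefixal V →
    (U : Factorization x) → UnborderedPrefixal U →
    (φ : ℕ → List (Fin k)) → Derived.IsPhi U φ →
    Σ (Factorization (Derived.δ U))
      (λ W → (∀ i → concatMap φ (block W i) ≡ block V i)
        × (∀ (W' : Factorization (Derived.δ U)) →
             (∀ i → concatMap φ (block W' i) ≡ block V i) →
             ∀ i → block W' i ≡ block W i))
mainTheorem10 x V prefixal U unborderedPrefixal φ isPhi = W , φW≡V , unique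
  where
  open Derived U using (δ)

  V⊆U : ∀ i → ∃[ j ] cut U j ≡ cut V i
  V⊆U = prefixal-cut-is-unbordered-cut V prefixal U unborderedPrefixal

  W : Factorization δ
  W = cutIndices U V V⊆U δ

  φW≡V : ∀ i → concatMap φ (block W i) ≡ block V i
  φW≡V i = trans (concatMap-slice U δ φ (φ∘δ≡block U φ isPhi) (<⇒≤ (cut< W i)))
                 (cong₂ (slice x) (proj₂ (V⊆U i)) (proj₂ (V⊆U (suc i))))

  unique : ∀ W' → (∀ i → concatMap φ (block W' i) ≡ block V i) → ∀ i → block W' i ≡ block W i
  unique W' φW'≡V i = cong₂ (slice δ) (W'≡W i) (W'≡W (suc i))
    where
    W'≡W : ∀ i → cut W' i ≡ cut W i
    W'≡W = cut-determined-by-image U δ φ (φ∘δ≡block U φ isPhi) W' W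
      (λ j → trans (φW'≡V j) (sym (φW≡V j)))
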